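{- For every uniformity $r \ge 2$ and residue $k \not\equiv 0 \pmod r$, we have $\gamma(\mathcal{C}_{\equiv k}^r\text{ - }\mathrm{hom}) \le 1/2$.
   Context: An $r$-graph is an $r$-uniform hypergraph; $\delta_{r-1}(\mathcal{H})$ is the minimum number of edges containing an $(r-1)$-set of vertices. For a family $\mathcal{F}$, $\mathrm{ex}_{r-1}(n,\mathcal{F})$ is the maximum of $\delta_{r-1}(\mathcal{H})$ over $n$-vertex $r$-graphs containing no member of $\mathcal{F}$, and $\gamma(\mathcal{F}) = \lim_{n\to\infty}\mathrm{ex}_{r-1}(n,\mathcal{F})/n$. $\mathcal{C}_\ell^r$ ($\ell>r$) is the tight cycle on $\{0,\ldots,\ell-1\}$ with edges $\{i,\ldots,i+r-1\}$ modulo $\ell$; $\mathcal{C}_{\equiv k}^r$ is the family of tight cycles with $\ell\equiv k \pmod r$; $\mathcal{F}\text{ - }\mathrm{hom}$ is the family of homomorphic images of members of $\mathcal{F}$ (images under edge-preserving vertex maps that are surjective on edges). -}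

module Defs where

open import Data.Nat using (ℕ; zero; suc; _+_; _*_; _∸_; _<_; _≡ᵇ_; _⊓_; NonZero)
open import Data.Nat.DivMod using (_%_; m%n<n)
open import Data.Bool using (Bool; true; false; _∧_; _∨_; not; if_then_else_)
open import Data.Fin using (Fin; zero; suc; toℕ; fromℕ<; _≟_)
open import Data.Fin.Subset using (Subset; ⁅_⁆; _∪_; ∣_∣) renaming (⊥ to ∅)
open import Data.Vec using ([]; _∷_; lookup; tabulate)
open import Data.List using (List; []; _∷_; map; foldr; upTo; _++_)
open import Data.Product using (Σ; ∃; _×_; proj₁)
open import Relation.Binary.PropositionalEquality using (_≡_)
open import Relation.Nullary using (¬_)
open import Relation.Nullary.Decidable using (⌊_⌋)
open import Function using (_∘_)
open import Function.Definitions using (Injective)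

Congr : ℕ → ℕ → ℕ → Set
Congr r a b = ∃ λ x → ∃ λ y → a + x * r ≡ b + y * r

anyFin : ∀ {a} → (Fin a → Bool) → Bool
anyFin {zero} _ = false
anyFin {suc a} p = p zero ∨ anyFin (p ∘ suc)

countFin : ∀ {a} → (Fin a → Bool) → ℕ
countFin {zero} _ = 0
countFin {suc a} p = (if p zero then 1 else 0) + countFin (p ∘ suc)

image : ∀ {a b} → (Fin a → Fin b) → Subset a → Subset b
image f S = tabulate λ y → anyFin λ x → lookup S x ∧ ⌊ f x ≟ y ⌋

setOf : ∀ {m} → List (Fin m) → Subset m
setOf = foldr (λ v S → ⁅ v ⁆ ∪ S) ∅

RGraph : ℕ → ℕ → Set
RGraph r n = Σ (Subset n → Bool) λ E → ∀ S → E S ≡ true → ∣ S ∣ ≡ r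

allSubsets : ∀ n → List (Subset n)
allSubsets zero = [] ∷ []
allSubsets (suc n) = map (true ∷_) (allSubsets n) ++ map (false ∷_) (allSubsets n)

-- number of edges containing the set S (i.e. vertices v ∉ S with S ∪ {v} an edge)
codeg : ∀ {r n} → RGraph r n → Subset n → ℕ
codeg H S = countFin λ v → not (lookup S v) ∧ proj₁ H (⁅ v ⁆ ∪ S)

-- δ_{r-1}(H): minimum of codeg over (r-1)-subsets.  (Default value n is
-- irrelevant whenever an (r-1)-set exists, since every codegree is < n then.)
minCodeg : ∀ {r n} → RGraph r n → ℕ
minCodeg {r} {n} H =
  foldr (λ S acc → if ∣ S ∣ ≡ᵇ (r ∸ 1) then codeg H S ⊓ acc else acc) n (allSubsets n)

-- Tight cycle C^r_ℓ on {0,…,ℓ-1}: edges {i,…,i+r-1} mod ℓ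
cycVert : (ℓ : ℕ) .{{_ : NonZero ℓ}} → Fin ℓ → ℕ → Fin ℓ
cycVert ℓ i j = fromℕ< (m%n<n (toℕ i + j) ℓ)

TightCycle : (r ℓ : ℕ) .{{_ : NonZero ℓ}} → Subset ℓ → Set
TightCycle r ℓ S = ∃ λ (i : Fin ℓ) → S ≡ setOf (map (cycVert ℓ i) (upTo r))

-- G (r-graph on Fin m given by edge predicate EG) is a homomorphic image of
-- C^r_ℓ: some vertex map φ sends every edge of C^r_ℓ to an edge of G
-- (an r-set), and every edge of G is the image of some edge of C^r_ℓ.
IsCycleHomImage : (r ℓ : ℕ) .{{_ : NonZero ℓ}} → ∀ {m} → (Subset m → Set) → Set
IsCycleHomImage r ℓ {m} EG = Σ (Fin ℓ → Fin m) λ φ →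
  (∀ S → TightCycle r ℓ S → ∣ image φ S ∣ ≡ r × EG (image φ S)) ×
  (∀ T → EG T → ∃ λ S → TightCycle r ℓ S × T ≡ image φ S)

Contains : ∀ {r n m} → RGraph r n → (Subset m → Set) → Set
Contains {m = m} H EG = Σ (Fin m → Fin _) λ ψ →
  Injective _≡_ _≡_ ψ × (∀ T → EG T → proj₁ H (image ψ T) ≡ true)

HomFree : (r k : ℕ) → ∀ {n} → RGraph r n → Set₁
HomFree r k H = ∀ ℓ .{{_ : NonZero ℓ}} → r < ℓ → Congr r ℓ k →
  ∀ m (EG : Subset m → Set) → IsCycleHomImage r ℓ EG → ¬ Contains H EG

-- If 2 δ_{r-1}(H) > n, any two (r-1)-sets have a common neighbour. Put m = r - 1, fix an edge
-- e = {a, b₀, …, b_{m-1}} (indices of b are read mod m) and, for every q, a common neighbour W_q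
-- of S₀ = {b₀, …, b_{m-1}} and e ∖ {b_q}. Concatenating the blocks W_q a b_{q+1} … b_{q+m} gives
-- a walk in which any r consecutive vertices span e, {W_q} ∪ S₀ or {W_q} ∪ (e ∖ {b_q}), hence an
-- edge. The walk has period m(r+1) = r² - 1; closing it after c periods gives a homomorphic image
-- of the tight cycle of length c(r² - 1) ≡ -c (mod r), and c = r - (k mod r) makes this ≡ k.
module Submission where

open import Defs
open import Algebra.Bundles using (CommutativeMonoid)
import Algebra.Properties.CommutativeSemigroup as CommutativeSemigroupProperties
open import Data.Bool using (Bool; true; false; _∧_; _∨_; if_then_else_; T)
open import Data.Bool.Properties using (∨-commutativeMonoid; ∨-identityʳ; ∧-distribʳ-∨; ¬-not)
open import Data.Empty using (⊥-elim)
open import Data.Fin using (Fin; zero; suc; toℕ; fromℕ<; _≟_)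
open import Data.Fin.Properties using (toℕ-fromℕ<; fromℕ<-cong)
open import Data.Fin.Subset using (Subset; ⁅_⁆; _∪_; ∣_∣) renaming (⊥ to ∅)
open import Data.Fin.Subset.Properties
  using (∪-commutativeMonoid; ∪-identityˡ; ∣⊥∣≡0; ∣p∣≤∣x∷p∣; x∈⁅x⁆; x∈⁅y⁆⇒x≡y)
open import Data.List using (List; []; _∷_; _∷ʳ_; map; foldr; upTo; applyUpTo; length)
open import Data.List.Properties
  using (applyUpTo-∷ʳ; length-applyUpTo; map-∘; map-upTo; map-id)
open import Data.List.Membership.Propositional using (_∈_)
open import Data.List.Membership.Propositional.Properties using (∈-++⁺ˡ; ∈-++⁺ʳ; ∈-map⁺)
open import Data.List.Relation.Unary.All using (All; []; _∷_)
open import Data.List.Relation.Unary.AllPairs using ([]; _∷_)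
open import Data.List.Relation.Unary.Any using (here; there)
open import Data.List.Relation.Unary.Unique.Propositional using (Unique)
open import Data.List.Relation.Unary.Unique.Propositional.Properties using (applyUpTo⁺₁)
open import Data.Nat
  using (ℕ; zero; suc; _+_; _*_; _∸_; _≤_; _<_; _≡ᵇ_; _⊓_; NonZero; z≤n; s≤s; s≤s⁻¹; z<s; >-nonZero)
open import Data.Nat.DivMod
open import Data.Nat.Divisibility using (_∣_; divides)
open import Data.Nat.Properties hiding (_≟_)
open import Data.Nat.Tactic.RingSolver using (solve-∀)
open import Data.Product using (Σ; ∃; _×_; _,_; proj₁; proj₂; map₂)
import Data.Product as Product
open import Data.Vec using (Vec; []; _∷_; lookup)
open import Data.Vec.Properties
  using (lookup-replicate; lookup-zipWith; lookup∘tabulate; tabulate∘lookup; tabulate-cong;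
         []=⇒lookup; lookup⇒[]=)
open import Function using (_∘_; id)
open import Relation.Binary.PropositionalEquality
open import Relation.Nullary using (¬_; yes; no)
open import Relation.Nullary.Decidable using (⌊_⌋)

module ∨-Properties =
  CommutativeSemigroupProperties (CommutativeMonoid.commutativeSemigroup ∨-commutativeMonoid)
module ∪-Properties (n : ℕ) =
  CommutativeSemigroupProperties (CommutativeMonoid.commutativeSemigroup (∪-commutativeMonoid n))

-- Subsets and their images

lookup-ext : ∀ {A : Set} {n} {u v : Vec A n} → (∀ x → lookup u x ≡ lookup v x) → u ≡ v
lookup-ext {u = u} {v} u≗v =
  trans (sym (tabulate∘lookup u)) (trans (tabulate-cong u≗v) (tabulate∘lookup v))

lookup-∅ : ∀ {n} (x : Fin n) → lookup (∅ {n}) x ≡ false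
lookup-∅ x = lookup-replicate x false

lookup-∪ : ∀ {n} (p q : Subset n) x → lookup (p ∪ q) x ≡ lookup p x ∨ lookup q x
lookup-∪ p q x = lookup-zipWith _∨_ x p q

lookup-⁅⁆-≢ : ∀ {n} {v x : Fin n} → v ≢ x → lookup ⁅ v ⁆ x ≡ false
lookup-⁅⁆-≢ {v = v} {x} v≢x = ¬-not (v≢x ∘ sym ∘ x∈⁅y⁆⇒x≡y v ∘ lookup⇒[]= x ⁅ v ⁆)

lookup-⁅⁆ : ∀ {n} (v x : Fin n) → lookup ⁅ v ⁆ x ≡ ⌊ v ≟ x ⌋
lookup-⁅⁆ v x with v ≟ x
... | yes refl = []=⇒lookup (x∈⁅x⁆ v)
... | no v≢x = lookup-⁅⁆-≢ v≢x

anyFin-cong : ∀ {a} {p q : Fin a → Bool} → (∀ x → p x ≡ q x) → anyFin p ≡ anyFin q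
anyFin-cong {zero} _ = refl
anyFin-cong {suc a} p≗q = cong₂ _∨_ (p≗q zero) (anyFin-cong (p≗q ∘ suc))

anyFin-false : ∀ {a} {p : Fin a → Bool} → (∀ x → p x ≡ false) → anyFin p ≡ false
anyFin-false {zero} _ = refl
anyFin-false {suc a} p≗false = cong₂ _∨_ (p≗false zero) (anyFin-false (p≗false ∘ suc))

anyFin-∨ : ∀ {a} (p q : Fin a → Bool) → anyFin (λ x → p x ∨ q x) ≡ anyFin p ∨ anyFin q
anyFin-∨ {zero} _ _ = refl
anyFin-∨ {suc a} p q =
  trans (cong ((p zero ∨ q zero) ∨_) (anyFin-∨ (p ∘ suc) (q ∘ suc)))
        (∨-Properties.interchange (p zero) (q zero) _ _)

anyFin-⁅⁆-∧ : ∀ {a} (v : Fin a) (g : Fin a → Bool) → anyFin (λ x → lookup ⁅ v ⁆ x ∧ g x) ≡ g v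
anyFin-⁅⁆-∧ zero g =
  trans (cong (g zero ∨_) (anyFin-false λ x → cong (_∧ g (suc x)) (lookup-∅ x)))
        (∨-identityʳ (g zero))
anyFin-⁅⁆-∧ (suc v) g = anyFin-⁅⁆-∧ v (g ∘ suc)

image-∅ : ∀ {a b} (f : Fin a → Fin b) → image f ∅ ≡ ∅
image-∅ f = lookup-ext λ y →
  trans (lookup∘tabulate _ y)
        (trans (anyFin-false λ x → cong (_∧ ⌊ f x ≟ y ⌋) (lookup-∅ x)) (sym (lookup-∅ y)))

image-⁅⁆∪ : ∀ {a b} (f : Fin a → Fin b) v S → image f (⁅ v ⁆ ∪ S) ≡ ⁅ f v ⁆ ∪ image f S
image-⁅⁆∪ {a} {b} f v S = lookup-ext λ y → begin
  lookup (image f (⁅ v ⁆ ∪ S)) y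
    ≡⟨ lookup∘tabulate _ y ⟩
  anyFin (λ x → lookup (⁅ v ⁆ ∪ S) x ∧ hits x y)
    ≡⟨ anyFin-cong (λ x → trans (cong (_∧ hits x y) (lookup-∪ ⁅ v ⁆ S x))
                                (∧-distribʳ-∨ (hits x y) (lookup ⁅ v ⁆ x) (lookup S x))) ⟩
  anyFin (λ x → (lookup ⁅ v ⁆ x ∧ hits x y) ∨ (lookup S x ∧ hits x y))
    ≡⟨ anyFin-∨ (λ x → lookup ⁅ v ⁆ x ∧ hits x y) (λ x → lookup S x ∧ hits x y) ⟩
  anyFin (λ x → lookup ⁅ v ⁆ x ∧ hits x y) ∨ anyFin (λ x → lookup S x ∧ hits x y)
    ≡⟨ cong₂ _∨_ (trans (anyFin-⁅⁆-∧ v (λ x → hits x y)) (sym (lookup-⁅⁆ (f v) y)))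
                 (sym (lookup∘tabulate _ y)) ⟩
  lookup ⁅ f v ⁆ y ∨ lookup (image f S) y
    ≡⟨ sym (lookup-∪ ⁅ f v ⁆ (image f S) y) ⟩
  lookup (⁅ f v ⁆ ∪ image f S) y ∎
  where
    open ≡-Reasoning
    hits : Fin a → Fin b → Bool
    hits x y = ⌊ f x ≟ y ⌋

image-setOf : ∀ {a b} (f : Fin a → Fin b) (L : List (Fin a)) → image f (setOf L) ≡ setOf (map f L)
image-setOf f [] = image-∅ f
image-setOf f (v ∷ L) = trans (image-⁅⁆∪ f v (setOf L)) (cong (⁅ f v ⁆ ∪_) (image-setOf f L))

-- Lists of vertices as sets

applyUpTo-cong< : ∀ {A : Set} {f g : ℕ → A} k → (∀ i → i < k → f i ≡ g i) →
                  applyUpTo f k ≡ applyUpTo g k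
applyUpTo-cong< zero _ = refl
applyUpTo-cong< (suc k) f≗g =
  cong₂ _∷_ (f≗g 0 z<s) (applyUpTo-cong< k λ i i<k → f≗g (suc i) (s≤s i<k))

setOf-∷ʳ : ∀ {n} (L : List (Fin n)) x → setOf (L ∷ʳ x) ≡ setOf (x ∷ L)
setOf-∷ʳ [] x = refl
setOf-∷ʳ {n} (y ∷ L) x =
  trans (cong (⁅ y ⁆ ∪_) (setOf-∷ʳ L x)) (∪-Properties.x∙yz≈y∙xz n ⁅ y ⁆ ⁅ x ⁆ (setOf L))

setOf-rotate : ∀ {n} (f : ℕ → Fin n) k → f k ≡ f 0 →
               setOf (applyUpTo (f ∘ suc) k) ≡ setOf (applyUpTo f k)
setOf-rotate f zero _ = refl
setOf-rotate f (suc k) fk≡f0 = begin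
  setOf (applyUpTo (f ∘ suc) (suc k)) ≡⟨ cong setOf (sym (applyUpTo-∷ʳ (f ∘ suc) k)) ⟩
  setOf (L ∷ʳ f (suc k))              ≡⟨ setOf-∷ʳ L (f (suc k)) ⟩
  setOf (f (suc k) ∷ L)               ≡⟨ cong (λ x → setOf (x ∷ L)) fk≡f0 ⟩
  setOf (applyUpTo f (suc k))         ∎
  where
    open ≡-Reasoning
    L = applyUpTo (f ∘ suc) k

setOf-shift : ∀ {n} k (f : ℕ → Fin n) → (∀ i → f (i + k) ≡ f i) →
              ∀ c → setOf (applyUpTo (λ i → f (c + i)) k) ≡ setOf (applyUpTo f k)
setOf-shift k f periodic zero = refl
setOf-shift k f periodic (suc c) =
  trans (setOf-shift k (f ∘ suc) (periodic ∘ suc) c) (setOf-rotate f k (periodic 0))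

lookup-setOf-∉ : ∀ {n} {x : Fin n} {L} → All (x ≢_) L → lookup (setOf L) x ≡ false
lookup-setOf-∉ {x = x} [] = lookup-∅ x
lookup-setOf-∉ {x = x} {y ∷ L} (x≢y ∷ x∉L) =
  trans (lookup-∪ ⁅ y ⁆ (setOf L) x) (cong₂ _∨_ (lookup-⁅⁆-≢ (x≢y ∘ sym)) (lookup-setOf-∉ x∉L))

∣⁅x⁆∪p∣≤1+∣p∣ : ∀ {n} (x : Fin n) (p : Subset n) → ∣ ⁅ x ⁆ ∪ p ∣ ≤ suc ∣ p ∣
∣⁅x⁆∪p∣≤1+∣p∣ zero (b ∷ p) =
  s≤s (subst (_≤ ∣ b ∷ p ∣) (cong ∣_∣ (sym (∪-identityˡ p))) (∣p∣≤∣x∷p∣ b p))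
∣⁅x⁆∪p∣≤1+∣p∣ (suc x) (true ∷ p) = s≤s (∣⁅x⁆∪p∣≤1+∣p∣ x p)
∣⁅x⁆∪p∣≤1+∣p∣ (suc x) (false ∷ p) = ∣⁅x⁆∪p∣≤1+∣p∣ x p

∣⁅x⁆∪p∣≡1+∣p∣ : ∀ {n} (x : Fin n) (p : Subset n) → lookup p x ≡ false →
                ∣ ⁅ x ⁆ ∪ p ∣ ≡ suc ∣ p ∣
∣⁅x⁆∪p∣≡1+∣p∣ zero (false ∷ p) _ = cong (suc ∘ ∣_∣) (∪-identityˡ p)
∣⁅x⁆∪p∣≡1+∣p∣ (suc x) (true ∷ p) x∉p = cong suc (∣⁅x⁆∪p∣≡1+∣p∣ x p x∉p)
∣⁅x⁆∪p∣≡1+∣p∣ (suc x) (false ∷ p) x∉p = ∣⁅x⁆∪p∣≡1+∣p∣ x p x∉p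

∣setOf∣≤length : ∀ {n} (L : List (Fin n)) → ∣ setOf L ∣ ≤ length L
∣setOf∣≤length {n} [] = ≤-reflexive (∣⊥∣≡0 n)
∣setOf∣≤length (x ∷ L) = ≤-trans (∣⁅x⁆∪p∣≤1+∣p∣ x (setOf L)) (s≤s (∣setOf∣≤length L))

∣setOf∣≡length : ∀ {n} {L : List (Fin n)} → Unique L → ∣ setOf L ∣ ≡ length L
∣setOf∣≡length {n} [] = ∣⊥∣≡0 n
∣setOf∣≡length {L = x ∷ L} (x∉L ∷ unique) =
  trans (∣⁅x⁆∪p∣≡1+∣p∣ x (setOf L) (lookup-setOf-∉ x∉L)) (cong suc (∣setOf∣≡length unique))

-- Codegrees

countFin-pigeonhole : ∀ {a} (p q : Fin a → Bool) → a < countFin p + countFin q →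
                      ∃ λ x → p x ≡ true × q x ≡ true
countFin-pigeonhole {zero} p q ()
countFin-pigeonhole {suc a} p q a<pq with p zero in p0 | q zero in q0
... | true  | true  = zero , p0 , q0
... | true  | false =
  Product.map suc id (countFin-pigeonhole (p ∘ suc) (q ∘ suc) (s≤s⁻¹ a<pq))
... | false | true  =
  Product.map suc id (countFin-pigeonhole (p ∘ suc) (q ∘ suc)
                                          (s≤s⁻¹ (subst (suc a <_) (+-suc _ _) a<pq)))
... | false | false =
  Product.map suc id (countFin-pigeonhole (p ∘ suc) (q ∘ suc) (<-trans (n<1+n a) a<pq))

∈-allSubsets : ∀ {n} (S : Subset n) → S ∈ allSubsets n
∈-allSubsets [] = here refl
∈-allSubsets {suc n} (true ∷ S) = ∈-++⁺ˡ (∈-map⁺ (true ∷_) (∈-allSubsets S))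
∈-allSubsets {suc n} (false ∷ S) =
  ∈-++⁺ʳ (map (true ∷_) (allSubsets n)) (∈-map⁺ (false ∷_) (∈-allSubsets S))

module _ {r n : ℕ} (H : RGraph r n) where

  Edge : Subset n → Set
  Edge S = proj₁ H S ≡ true

  minCodeg≤codeg : ∀ S → ∣ S ∣ ≡ r ∸ 1 → minCodeg H ≤ codeg H S
  minCodeg≤codeg S ∣S∣ = foldr-step≤ (allSubsets n) (∈-allSubsets S)
    where
      step : Subset n → ℕ → ℕ
      step S′ acc = if ∣ S′ ∣ ≡ᵇ (r ∸ 1) then codeg H S′ ⊓ acc else acc

      step≤ : ∀ S′ acc → step S′ acc ≤ acc
      step≤ S′ acc with ∣ S′ ∣ ≡ᵇ (r ∸ 1)
      ... | true  = m⊓n≤n (codeg H S′) acc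
      ... | false = ≤-refl

      foldr-step≤ : ∀ L → S ∈ L → foldr step n L ≤ codeg H S
      foldr-step≤ (.S ∷ L) (here refl) with ∣ S ∣ ≡ᵇ (r ∸ 1) in ∣S∣≡ᵇ
      ... | true  = m⊓n≤m (codeg H S) _
      ... | false = ⊥-elim (subst T ∣S∣≡ᵇ (≡⇒≡ᵇ _ _ ∣S∣))
      foldr-step≤ (S′ ∷ L) (there S∈L) = ≤-trans (step≤ S′ (foldr step n L)) (foldr-step≤ L S∈L)

  common-neighbour : ∀ S S′ → n < codeg H S + codeg H S′ →
                     ∃ λ v → Edge (⁅ v ⁆ ∪ S) × Edge (⁅ v ⁆ ∪ S′)
  common-neighbour S S′ n<codeg =
    map₂ (Product.map ∧-elimʳ ∧-elimʳ) (countFin-pigeonhole _ _ n<codeg)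
    where
      ∧-elimʳ : ∀ {x y} → x ∧ y ≡ true → y ≡ true
      ∧-elimʳ {true} y≡true = y≡true

-- Closed walks and homomorphic images of tight cycles

module _ {A : Set} {f : ℕ → A} {p : ℕ} (periodic : ∀ x → f (x + p) ≡ f x) where

  periodic-multiple : ∀ k x → f (x + k * p) ≡ f x
  periodic-multiple zero x = cong f (+-identityʳ x)
  periodic-multiple (suc k) x = begin
    f (x + (p + k * p)) ≡⟨ cong f (sym (+-assoc x p (k * p))) ⟩
    f (x + p + k * p)   ≡⟨ periodic-multiple k (x + p) ⟩
    f (x + p)           ≡⟨ periodic x ⟩
    f x                 ∎
    where open ≡-Reasoning

  periodic-% : .{{_ : NonZero p}} → ∀ x → f (x % p) ≡ f x
  periodic-% x =
    trans (sym (periodic-multiple (x / p) (x % p))) (cong f (sym (m≡m%n+[m/n]*n x p)))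

window : ∀ {n} → ℕ → (ℕ → Fin n) → ℕ → List (Fin n)
window r C t = applyUpTo (λ j → C (t + j)) r

window-rotate : ∀ {n} r (C : ℕ → Fin n) t → C t ≡ C (t + r) →
                setOf (window r C (suc t)) ≡ setOf (window r C t)
window-rotate r C t Ct≡Ct+r =
  trans (cong setOf (applyUpTo-cong< r λ j _ → cong C (sym (+-suc t j))))
        (setOf-rotate (λ j → C (t + j)) r (trans (sym Ct≡Ct+r) (cong C (sym (+-identityʳ t)))))

window-stable : ∀ {n} r (C : ℕ → Fin n) t k → (∀ j → j < k → C (t + j) ≡ C (t + j + r)) →
                setOf (window r C (t + k)) ≡ setOf (window r C t)
window-stable r C t zero _ = cong (setOf ∘ window r C) (+-identityʳ t)
window-stable r C t (suc k) repeats = begin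
  setOf (window r C (t + suc k))   ≡⟨ cong (setOf ∘ window r C) (+-suc t k) ⟩
  setOf (window r C (suc (t + k))) ≡⟨ window-rotate r C (t + k) (repeats k (n<1+n k)) ⟩
  setOf (window r C (t + k))       ≡⟨ window-stable r C t k (λ j j<k → repeats j (m<n⇒m<1+n j<k)) ⟩
  setOf (window r C t)             ∎
  where open ≡-Reasoning

closedWalk⇒homImage : ∀ {r n} (H : RGraph r n) ℓ .{{_ : NonZero ℓ}} (C : ℕ → Fin n) →
  (∀ x → C (x + ℓ) ≡ C x) → (∀ t → Edge H (setOf (window r C t))) →
  Σ (Subset n → Set) λ EG → IsCycleHomImage r ℓ EG × Contains H EG
closedWalk⇒homImage {r} {n} H ℓ C periodic windows =
  EG , (φ , (λ S cyc → proj₂ H _ (edge S cyc) , S , cyc , refl) , λ _ EG-T → EG-T) ,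
  (id , id , contained)
  where
    φ : Fin ℓ → Fin n
    φ i = C (toℕ i)

    EG : Subset n → Set
    EG T = ∃ λ S → TightCycle r ℓ S × T ≡ image φ S

    image-cycleEdge : ∀ i →
      image φ (setOf (map (cycVert ℓ i) (upTo r))) ≡ setOf (window r C (toℕ i))
    image-cycleEdge i = trans (image-setOf φ (map (cycVert ℓ i) (upTo r))) (cong setOf (begin
      map φ (map (cycVert ℓ i) (upTo r)) ≡⟨ sym (map-∘ (upTo r)) ⟩
      map (φ ∘ cycVert ℓ i) (upTo r)     ≡⟨ map-upTo (φ ∘ cycVert ℓ i) r ⟩
      applyUpTo (φ ∘ cycVert ℓ i) r      ≡⟨ applyUpTo-cong< r (λ j _ →
                                              trans (cong C (toℕ-fromℕ< (m%n<n (toℕ i + j) ℓ)))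
                                                    (periodic-% periodic (toℕ i + j))) ⟩
      window r C (toℕ i)                 ∎))
      where open ≡-Reasoning

    edge : ∀ S → TightCycle r ℓ S → Edge H (image φ S)
    edge S (i , refl) = subst (Edge H) (sym (image-cycleEdge i)) (windows (toℕ i))

    contained : ∀ T → EG T → Edge H (image id T)
    contained T (S , (i , refl) , refl) = subst (Edge H) (sym image-id) (edge S (i , refl))
      where
        W = window r C (toℕ i)
        image-id : image id (image φ S) ≡ image φ S
        image-id = begin
          image id (image φ S) ≡⟨ cong (image id) (image-cycleEdge i) ⟩
          image id (setOf W)   ≡⟨ image-setOf id W ⟩
          setOf (map id W)     ≡⟨ cong setOf (map-id W) ⟩
          setOf W              ≡⟨ sym (image-cycleEdge i) ⟩
          image φ S            ∎
          where open ≡-Reasoning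

closedWalk⇒¬HomFree : ∀ {r n k} (H : RGraph r n) ℓ .{{_ : NonZero ℓ}} (C : ℕ → Fin n) →
  r < ℓ → Congr r ℓ k → (∀ x → C (x + ℓ) ≡ C x) → (∀ t → Edge H (setOf (window r C t))) →
  ¬ HomFree r k H
closedWalk⇒¬HomFree {n = n} H ℓ C r<ℓ ℓ≡k periodic windows homFree =
  let EG , homImage , contained = closedWalk⇒homImage H ℓ C periodic windows
  in homFree ℓ r<ℓ ℓ≡k n EG homImage contained

-- c (r² - 1) ≡ -c (mod r), and c + k mod r = r.
Congr-cycleLength : ∀ m k → let r = suc m in Congr r ((r ∸ k % r) * (m * suc r)) k
Congr-cycleLength m k = suc (k / r) , c * r , (begin
  ℓ + (r + k / r * r)         ≡⟨ cong (λ x → ℓ + (x + k / r * r)) (sym c+k%r≡r) ⟩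
  ℓ + (c + k % r + k / r * r) ≡⟨ regroup ℓ c (k % r) (k / r * r) ⟩
  ℓ + c + (k % r + k / r * r) ≡⟨ cong₂ _+_ (ℓ+c≡c*r*r c m) (sym (m≡m%n+[m/n]*n k r)) ⟩
  c * r * r + k               ≡⟨ +-comm (c * r * r) k ⟩
  k + c * r * r               ∎)
  where
    open ≡-Reasoning
    r = suc m
    c = r ∸ k % r
    ℓ = c * (m * suc r)
    c+k%r≡r : c + k % r ≡ r
    c+k%r≡r = m∸n+n≡m (<⇒≤ (m%n<n k r))
    regroup : ∀ a b c d → a + (b + c + d) ≡ a + b + (c + d)
    regroup = solve-∀
    ℓ+c≡c*r*r : ∀ c m → c * (m * suc (suc m)) + c ≡ c * suc m * suc m
    ℓ+c≡c*r*r = solve-∀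

-- The walk in a hypergraph of large minimum codegree

module DenseWalk {m′ n : ℕ} (H : RGraph (suc (suc m′)) n) (m≤n : suc m′ ≤ n)
                 (dense : n < minCodeg H + minCodeg H) where

  m r d : ℕ
  m = suc m′
  r = suc m
  d = suc r

  neighbour : ∀ S S′ → ∣ S ∣ ≡ m → ∣ S′ ∣ ≡ m → ∃ λ v → Edge H (⁅ v ⁆ ∪ S) × Edge H (⁅ v ⁆ ∪ S′)
  neighbour S S′ ∣S∣ ∣S′∣ = common-neighbour H S S′
    (<-≤-trans dense (+-mono-≤ (minCodeg≤codeg H S ∣S∣) (minCodeg≤codeg H S′ ∣S′∣)))

  b : ℕ → Fin n
  b i = fromℕ< (<-≤-trans (m%n<n i m) m≤n)

  b-cong-% : ∀ i j → i % m ≡ j % m → b i ≡ b j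
  b-cong-% i j i≡j = fromℕ<-cong (i % m) (j % m) i≡j _ _

  b-periodic : ∀ i → b (i + m) ≡ b i
  b-periodic i = b-cong-% (i + m) i ([m+n]%n≡m%n i m)

  S₀ : Subset n
  S₀ = setOf (applyUpTo b m)

  ∣S₀∣ : ∣ S₀ ∣ ≡ m
  ∣S₀∣ = trans (∣setOf∣≡length (applyUpTo⁺₁ b m b-distinct)) (length-applyUpTo b m)
    where
      toℕ-b : ∀ {i} → i < m → toℕ (b i) ≡ i
      toℕ-b i<m = trans (toℕ-fromℕ< _) (m<n⇒m%n≡m i<m)
      b-distinct : ∀ {i j} → i < j → j < m → b i ≢ b j
      b-distinct i<j j<m bi≡bj =
        <⇒≢ i<j (trans (sym (toℕ-b (<-trans i<j j<m))) (trans (cong toℕ bi≡bj) (toℕ-b j<m)))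

  a : Fin n
  a = proj₁ (neighbour S₀ S₀ ∣S₀∣ ∣S₀∣)

  e : Subset n
  e = ⁅ a ⁆ ∪ S₀

  e-edge : Edge H e
  e-edge = proj₁ (proj₂ (neighbour S₀ S₀ ∣S₀∣ ∣S₀∣))

  B rest : ℕ → List (Fin n)
  B q = applyUpTo (λ s → b (suc (q + s))) m
  rest q = applyUpTo (λ s → b (suc (q + s))) m′

  setOf-B : ∀ q → setOf (B q) ≡ S₀
  setOf-B q = setOf-shift m b b-periodic (suc q)

  -- The vertex removed from e is b (suc (q + m′)), that is b_{q+m} = b_q.
  e∖b : ℕ → Subset n
  e∖b q = setOf (a ∷ rest q)

  ⁅b⁆∪e∖b≡e : ∀ q → ⁅ b (suc (q + m′)) ⁆ ∪ e∖b q ≡ e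
  ⁅b⁆∪e∖b≡e q = begin
    ⁅ x ⁆ ∪ (⁅ a ⁆ ∪ setOf (rest q)) ≡⟨ ∪-Properties.x∙yz≈y∙xz n ⁅ x ⁆ ⁅ a ⁆ (setOf (rest q)) ⟩
    ⁅ a ⁆ ∪ setOf (x ∷ rest q)       ≡⟨ cong (⁅ a ⁆ ∪_) (sym (setOf-∷ʳ (rest q) x)) ⟩
    ⁅ a ⁆ ∪ setOf (rest q ∷ʳ x)      ≡⟨ cong (λ L → ⁅ a ⁆ ∪ setOf L) (applyUpTo-∷ʳ _ m′) ⟩
    ⁅ a ⁆ ∪ setOf (B q)              ≡⟨ cong (⁅ a ⁆ ∪_) (setOf-B q) ⟩
    e                                ∎
    where
      open ≡-Reasoning
      x = b (suc (q + m′))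

  ∣e∖b∣ : ∀ q → ∣ e∖b q ∣ ≡ m
  ∣e∖b∣ q = ≤-antisym
    (≤-trans (∣setOf∣≤length (a ∷ rest q)) (≤-reflexive (cong suc (length-applyUpTo _ m′))))
    (s≤s⁻¹ (begin
      r                                ≡⟨ sym (proj₂ H e e-edge) ⟩
      ∣ e ∣                            ≡⟨ cong ∣_∣ (sym (⁅b⁆∪e∖b≡e q)) ⟩
      ∣ ⁅ b (suc (q + m′)) ⁆ ∪ e∖b q ∣ ≤⟨ ∣⁅x⁆∪p∣≤1+∣p∣ (b (suc (q + m′))) (e∖b q) ⟩
      suc ∣ e∖b q ∣                    ∎))
    where open ≤-Reasoning

  e∖b-% : ∀ q → e∖b (q % m) ≡ e∖b q
  e∖b-% q = cong (λ L → setOf (a ∷ L)) (applyUpTo-cong< m′ λ s _ →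
    b-cong-% (suc (q % m + s)) (suc (q + s)) (begin
      suc (q % m + s) % m         ≡⟨ cong (_% m) (sym (+-suc (q % m) s)) ⟩
      (q % m + suc s) % m         ≡⟨ %-distribˡ-+ (q % m) (suc s) m ⟩
      (q % m % m + suc s % m) % m ≡⟨ cong (λ x → (x + suc s % m) % m) (m%n%n≡m%n q m) ⟩
      (q % m + suc s % m) % m     ≡⟨ sym (%-distribˡ-+ q (suc s) m) ⟩
      (q + suc s) % m             ≡⟨ cong (_% m) (+-suc q s) ⟩
      suc (q + s) % m             ∎))
    where open ≡-Reasoning

  common : ∀ c → ∃ λ v → Edge H (⁅ v ⁆ ∪ S₀) × Edge H (⁅ v ⁆ ∪ e∖b c)
  common c = neighbour S₀ (e∖b c) ∣S₀∣ (∣e∖b∣ c)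

  -- Choosing W_q by q mod m makes the walk periodic.
  W : ℕ → Fin n
  W q = proj₁ (common (q % m))

  W-S₀ : ∀ q → Edge H (⁅ W q ⁆ ∪ S₀)
  W-S₀ q = proj₁ (proj₂ (common (q % m)))

  W-e∖b : ∀ q → Edge H (⁅ W q ⁆ ∪ e∖b q)
  W-e∖b q = subst (λ S → Edge H (⁅ W q ⁆ ∪ S)) (e∖b-% q) (proj₂ (proj₂ (common (q % m))))

  D : ℕ → ℕ → Fin n
  D q 0 = W q
  D q 1 = a
  D q (suc (suc s)) = b (suc (q + s))

  D-periodic : ∀ q s → D (q + m) s ≡ D q s
  D-periodic q 0 = cong (proj₁ ∘ common) ([m+n]%n≡m%n q m)
  D-periodic q 1 = refl
  D-periodic q (suc (suc s)) = trans (cong (b ∘ suc) (regroup q m s)) (b-periodic (suc (q + s)))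
    where
      regroup : ∀ q m s → q + m + s ≡ q + s + m
      regroup = solve-∀

  C : ℕ → Fin n
  C x = D (x / d) (x % d)

  C-block : ∀ q p → p < d → C (q * d + p) ≡ D q p
  C-block q p p<d = cong₂ D
    (trans (+-distrib-/-∣ˡ p d∣qd)
           (trans (cong₂ _+_ (m*n/n≡m q d) (m<n⇒m/n≡0 p<d)) (+-identityʳ q)))
    (trans (%-remove-+ˡ p d∣qd) (m<n⇒m%n≡m p<d))
    where
      d∣qd : d ∣ q * d
      d∣qd = divides q refl

  C-periodic : ∀ x → C (x + m * d) ≡ C x
  C-periodic x = trans
    (cong₂ D (trans (+-distrib-/-∣ʳ x (divides m refl)) (cong (x / d +_) (m*n/n≡m m d)))
             ([m+kn]%n≡m%n x m d))
    (D-periodic (x / d) (x % d))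

  C-block-window : ∀ q s k → s + k ≤ d →
                   applyUpTo (λ j → C (q * d + s + j)) k ≡ applyUpTo (λ j → D q (s + j)) k
  C-block-window q s k s+k≤d = applyUpTo-cong< k λ j j<k →
    trans (cong C (+-assoc (q * d) s j)) (C-block q (s + j) (<-≤-trans (+-monoʳ-< s j<k) s+k≤d))

  window₀ : ∀ q → Edge H (setOf (window r C (q * d + 0)))
  window₀ q = subst (Edge H ∘ setOf) (sym (C-block-window q 0 r (n≤1+n r))) (W-e∖b q)

  window₁ : ∀ q → Edge H (setOf (window r C (q * d + 1)))
  window₁ q = subst (Edge H ∘ setOf) (sym (C-block-window q 1 r ≤-refl))
                (subst (λ S → Edge H (⁅ a ⁆ ∪ S)) (sym (setOf-B q)) e-edge)

  window₂ : ∀ q → Edge H (setOf (window r C (q * d + 2)))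
  window₂ q = subst (Edge H ∘ setOf) (sym split) (subst (Edge H) (sym sets) (W-S₀ (suc q)))
    where
      -- The ring solver treats d as an atom, so identities are stated for d = 3 + m′.
      arith : ∀ q m′ → q * (3 + m′) + 2 + suc m′ ≡ suc q * (3 + m′) + 0
      arith = solve-∀
      split : window r C (q * d + 2) ≡ B q ∷ʳ W (suc q)
      split = begin
        window r C (q * d + 2)
          ≡⟨ sym (applyUpTo-∷ʳ (λ j → C (q * d + 2 + j)) m) ⟩
        applyUpTo (λ j → C (q * d + 2 + j)) m ∷ʳ C (q * d + 2 + m)
          ≡⟨ cong₂ _∷ʳ_ (C-block-window q 2 m ≤-refl)
                        (trans (cong C (arith q m′)) (C-block (suc q) 0 z<s)) ⟩
        B q ∷ʳ W (suc q)
          ∎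
        where open ≡-Reasoning
      sets : setOf (B q ∷ʳ W (suc q)) ≡ ⁅ W (suc q) ⁆ ∪ S₀
      sets = trans (setOf-∷ʳ (B q) (W (suc q))) (cong (⁅ W (suc q) ⁆ ∪_) (setOf-B q))

  -- From position 3 on, block q + 1 repeats block q shifted by r, so all later windows of
  -- block q span the same set as the first window of block q + 1.
  C-repeats : ∀ q i → 3 + i < d → C (q * d + (3 + i)) ≡ C (q * d + (3 + i) + r)
  C-repeats q i 3+i<d = begin
    C (q * d + (3 + i))     ≡⟨ C-block q (3 + i) 3+i<d ⟩
    b (suc (q + suc i))     ≡⟨ cong (b ∘ suc) (+-suc q i) ⟩
    b (suc (suc q + i))     ≡⟨ sym (C-block (suc q) (2 + i) (<-trans (n<1+n (2 + i)) 3+i<d)) ⟩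
    C (suc q * d + (2 + i)) ≡⟨ cong C (arith q i m′) ⟩
    C (q * d + (3 + i) + r) ∎
    where
      open ≡-Reasoning
      arith : ∀ q i m′ → suc q * (3 + m′) + (2 + i) ≡ q * (3 + m′) + (3 + i) + (2 + m′)
      arith = solve-∀

  window₃₊ : ∀ q u → 3 + u < d → Edge H (setOf (window r C (q * d + (3 + u))))
  window₃₊ q u 3+u<d with m≤n⇒∃[o]m+o≡n (<⇒≤ 3+u<d)
  ... | k , 3+u+k≡d = subst (Edge H)
    (trans (cong (setOf ∘ window r C) (sym end)) (window-stable r C (q * d + (3 + u)) k repeats))
    (window₀ (suc q))
    where
      arith : ∀ q m′ → q * (3 + m′) + (3 + m′) ≡ suc q * (3 + m′) + 0
      arith = solve-∀
      end : q * d + (3 + u) + k ≡ suc q * d + 0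
      end = trans (+-assoc (q * d) (3 + u) k) (trans (cong (q * d +_) 3+u+k≡d) (arith q m′))
      repeats : ∀ j → j < k → C (q * d + (3 + u) + j) ≡ C (q * d + (3 + u) + j + r)
      repeats j j<k = subst (λ x → C x ≡ C (x + r)) (sym (+-assoc (q * d) (3 + u) j))
        (C-repeats q (u + j) (subst (3 + (u + j) <_) 3+u+k≡d (+-monoʳ-< (3 + u) j<k)))

  windows : ∀ t → Edge H (setOf (window r C t))
  windows t =
    subst (Edge H ∘ setOf ∘ window r C) (sym t≡) (block-window (t / d) (t % d) (m%n<n t d))
    where
      t≡ : t ≡ t / d * d + t % d
      t≡ = trans (m≡m%n+[m/n]*n t d) (+-comm (t % d) (t / d * d))
      block-window : ∀ q s → s < d → Edge H (setOf (window r C (q * d + s)))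
      block-window q 0 _ = window₀ q
      block-window q 1 _ = window₁ q
      block-window q 2 _ = window₂ q
      block-window q (suc (suc (suc u))) 3+u<d = window₃₊ q u 3+u<d

  ¬homFree : ∀ k → ¬ HomFree r k H
  ¬homFree k =
    closedWalk⇒¬HomFree H ℓ C r<ℓ (Congr-cycleLength m k) (periodic-multiple C-periodic c) windows
    where
      c ℓ : ℕ
      c = r ∸ k % r
      ℓ = c * (m * d)
      instance
        c≢0 : NonZero c
        c≢0 = >-nonZero (m<n⇒0<n∸m (m%n<n k r))
        ℓ≢0 : NonZero ℓ
        ℓ≢0 = m*n≢0 c (m * d)
      r<ℓ : r < ℓ
      r<ℓ = <-≤-trans (n<1+n r) (≤-trans (m≤n*m d m) (m≤n*m (m * d) c))

homFree⇒2δ≤n : ∀ {m′ n} k (H : RGraph (suc (suc m′)) n) → suc m′ ≤ n →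
               HomFree (suc (suc m′)) k H → minCodeg H + minCodeg H ≤ n
homFree⇒2δ≤n k H m≤n homFree = ≮⇒≥ λ dense → DenseWalk.¬homFree H m≤n dense k homFree

-- The argument works for every k.
lemma12 : ∀ (r k : ℕ) → 2 ≤ r → ¬ (r ∣ k) →
    ∀ (e : ℕ) → ∃ λ (N : ℕ) → ∀ (n : ℕ) → N ≤ n →
      ∀ (H : RGraph r n) → HomFree r k H →
        2 * suc e * minCodeg H ≤ suc e * n + 2 * n
lemma12 (suc (suc m′)) k (s≤s (s≤s z≤n)) _ e = suc m′ , λ n m≤n H homFree → begin
  2 * suc e * minCodeg H            ≡⟨ regroup (suc e) (minCodeg H) ⟩
  suc e * (minCodeg H + minCodeg H) ≤⟨ *-monoʳ-≤ (suc e) (homFree⇒2δ≤n k H m≤n homFree) ⟩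
  suc e * n                         ≤⟨ m≤m+n (suc e * n) (2 * n) ⟩
  suc e * n + 2 * n                 ∎
  where
    open ≤-Reasoning
    regroup : ∀ x δ → 2 * x * δ ≡ x * (δ + δ)
    regroup = solve-∀
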